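{- Let $\sigma$ be a well-shaped state with $|\sigma^{ -1}(3)|>0$ and $\sum_{i=0}^{2}|\sigma^{ -1}(i)|\le1$, and let $q=\mathrm{ch}(\sigma)$. Then there is a strategy of size $q$ that is winning for $\sigma$ and uses only $1$-interval questions.
   Context: Setting: $\mathcal U=\{0,\dots,2^m-1\}$, viewed cyclically, and the game allows $3$ lies. States: a state is a map $\sigma:\mathcal U\to\{0,\dots,4\}$, with $t_i=|\sigma^{ -1}(i)|$. Its support is $\Sigma=\{y:\sigma(y)\le3\}$, and it is final if $|\Sigma|\le1$. Answers: asking $Q$, the resulting states are $\sigma_{yes}(y)=\min\{\sigma(y)+[y\notin Q],4\}$ and $\sigma_{no}(y)=\min\{\sigma(y)+[y\in Q],4\}$. Volume and character: $w_q(\sigma)=\sum_{j=0}^3t_j\sum_{\ell=0}^{3-j}\binom q\ell$ and $\mathrm{ch}(\sigma)=\min\{q\ge 0:w_q(\sigma)\le2^q\}$. Strategies: a strategy of size $q$ is a complete binary tree of depth $q$ with questions at internal nodes. It is winning for $\sigma$ if every leaf state obtained from $\sigma$ is final. Intervals: an interval is empty or a set of cyclically consecutive elements of $\mathcal U$. A $1$-interval question is a single interval. Well shaped: order $\Sigma$ cyclically. The state is well shaped if $\Sigma$ splits into twelve possibly empty sets of cyclically consecutive elements of $\Sigma$, in cyclic order, on which $\sigma$ is constant with values either $2,1,0,1,2,3,2,1,2,3,2,3$ or $2,1,0,1,2,1,2,3,2,3,2,3$. -}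

module Defs where

open import Data.Nat using (ℕ; zero; suc; _+_; _*_; _∸_; _^_; _≤_; _<_; _≤?_; _%_)
open import Data.Nat.Properties using (_≟_; m^n≢0)
open import Data.Nat.Combinatorics using (_C_)
open import Data.Fin using (Fin; toℕ) renaming (zero to fz; suc to fs)
open import Data.Bool using (Bool; true; false; if_then_else_)
open import Data.List using (List; []; _∷_; length; filter; allFin; map; drop; take; _++_; replicate; concat)
open import Data.Vec using (Vec; toList; zipWith)
open import Data.Product using (Σ; ∃; ∃-syntax; _×_; _,_)
open import Data.Sum using (_⊎_)
open import Data.Unit using (⊤)
open import Function.Bundles using (_⇔_)
open import Relation.Nullary using (¬_)
open import Relation.Binary.PropositionalEquality using (_≡_)

U : ℕ → Set
U m = Fin (2 ^ m)

State : ℕ → Set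
State m = U m → Fin 5

val : ∀ m → State m → U m → ℕ
val m σ y = toℕ (σ y)

t : ∀ m → State m → ℕ → ℕ
t m σ i = length (filter (λ y → val m σ y ≟ i) (allFin (2 ^ m)))

support : ∀ m → State m → List (U m)
support m σ = filter (λ y → val m σ y ≤? 3) (allFin (2 ^ m))

Final : ∀ m → State m → Set
Final m σ = length (support m σ) ≤ 1

binomSum : ℕ → ℕ → ℕ
binomSum q zero = q C 0
binomSum q (suc k) = binomSum q k + q C (suc k)

w : ∀ m → ℕ → State m → ℕ
w m q σ = t m σ 0 * binomSum q 3 + t m σ 1 * binomSum q 2
        + t m σ 2 * binomSum q 1 + t m σ 3 * binomSum q 0

IsCharacter : ∀ m → State m → ℕ → Set
IsCharacter m σ q = (w m q σ ≤ 2 ^ q) × (∀ q′ → q′ < q → ¬ (w m q′ σ ≤ 2 ^ q′))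

Question : ℕ → Set
Question m = U m → Bool

bump : Fin 5 → Fin 5
bump fz = fs fz
bump (fs fz) = fs (fs fz)
bump (fs (fs fz)) = fs (fs (fs fz))
bump (fs (fs (fs fz))) = fs (fs (fs (fs fz)))
bump (fs (fs (fs (fs fz)))) = fs (fs (fs (fs fz)))

yesState : ∀ m → State m → Question m → State m
yesState m σ Q y = if Q y then σ y else bump (σ y)

noState : ∀ m → State m → Question m → State m
noState m σ Q y = if Q y then bump (σ y) else σ y

-- A strategy of size q: complete binary tree of depth q with questions
-- at internal nodes (first subtree = after answer yes, second = after no).
data Strategy (m : ℕ) : ℕ → Set where
  leaf : Strategy m zero
  node : ∀ {q} → Question m → Strategy m q → Strategy m q → Strategy m (suc q)

Winning : ∀ m {q} → Strategy m q → State m → Set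
Winning m leaf σ = Final m σ
Winning m (node Q sy sn) σ = Winning m sy (yesState m σ Q) × Winning m sn (noState m σ Q)

-- An interval: empty or a set of cyclically consecutive elements of U,
-- i.e. {a, a+1, …, a+len-1} (mod 2^m) for some start a and 0 ≤ len ≤ 2^m
-- (len = 0 gives the empty interval).
IsInterval : ∀ m → Question m → Set
IsInterval m Q = Σ (U m) λ a → Σ ℕ λ len → (len ≤ 2 ^ m) ×
  (∀ y → (Q y ≡ true) ⇔ (_%_ (toℕ y + (2 ^ m ∸ toℕ a)) (2 ^ m) {{m^n≢0 2 m}} < len))

OneIntervalOnly : ∀ m {q} → Strategy m q → Set
OneIntervalOnly m leaf = ⊤
OneIntervalOnly m (node Q sy sn) = IsInterval m Q × OneIntervalOnly m sy × OneIntervalOnly m sn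

pattern₁ : Vec ℕ 12
pattern₁ = 2 Data.Vec.∷ 1 Data.Vec.∷ 0 Data.Vec.∷ 1 Data.Vec.∷ 2 Data.Vec.∷ 3 Data.Vec.∷
           2 Data.Vec.∷ 1 Data.Vec.∷ 2 Data.Vec.∷ 3 Data.Vec.∷ 2 Data.Vec.∷ 3 Data.Vec.∷ Data.Vec.[]

pattern₂ : Vec ℕ 12
pattern₂ = 2 Data.Vec.∷ 1 Data.Vec.∷ 0 Data.Vec.∷ 1 Data.Vec.∷ 2 Data.Vec.∷ 1 Data.Vec.∷
           2 Data.Vec.∷ 3 Data.Vec.∷ 2 Data.Vec.∷ 3 Data.Vec.∷ 2 Data.Vec.∷ 3 Data.Vec.∷ Data.Vec.[]

supportValues : ∀ m → State m → List ℕ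
supportValues m σ = map (val m σ) (support m σ)

rotate : ∀ {A : Set} → ℕ → List A → List A
rotate i xs = drop i xs ++ take i xs

blocks : Vec ℕ 12 → Vec ℕ 12 → List ℕ
blocks ls p = concat (toList (zipWith replicate ls p))

-- Σ, read cyclically from some starting point, splits into twelve
-- (possibly empty) consecutive blocks on which σ is constant with the
-- values of pattern₁ or pattern₂ (in this order).
WellShaped : ∀ m → State m → Set
WellShaped m σ = Σ (Vec ℕ 12) λ p → ((p ≡ pattern₁) ⊎ (p ≡ pattern₂)) ×
  (Σ ℕ λ i → Σ (Vec ℕ 12) λ ls → (i ≤ length (supportValues m σ)) × (rotate i (supportValues m σ) ≡ blocks ls p))

-- At most one element has value ≤ 2, so each question can be taken to be an interval that
-- contains this element together with exactly i elements of value 3: counting value-3 elements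
-- along an initial segment grows by at most one per step, so a discrete intermediate value
-- argument finds such an interval, placed around the light element so that it never wraps.
-- If E and F are the volumes of the light element after a yes and after a no answer and k is
-- the number of value-3 elements, the two answers have volumes E + i and F + k − i, and
-- i = (F + k) ∸ 2^q makes both at most 2^q as soon as w_{q+1}(σ) = E + F + k ≤ 2^(q+1).
-- Induction on q gives the strategy.
module Submission where

open import Defs
open import Data.Nat using (ℕ; zero; suc; _+_; _*_; _∸_; _^_; _≤_; _<_; z≤n; s≤s; s≤s⁻¹; _%_; NonZero; _≤ᵇ_; _<ᵇ_; _≡ᵇ_)
open import Data.Nat.Properties
open import Data.Nat.Combinatorics using (_C_; nCk+nC[k+1]≡[n+1]C[k+1])
open import Data.Nat.Tactic.RingSolver using (solve-∀)
open import Data.Nat.DivMod using ([m+n]%n≡m%n; m<n⇒m%n≡m)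
open import Data.Fin using (Fin; toℕ; fromℕ<) renaming (zero to fz; suc to fs)
open import Data.Fin.Properties using (toℕ-injective; toℕ<n; toℕ-fromℕ<)
open import Data.Bool using (Bool; true; false; if_then_else_; _∧_)
open import Data.List using (length; filter; tabulate)
open import Data.Vec.Functional using (Vector)
open import Data.Product using (Σ; ∃-syntax; _×_; _,_)
open import Data.Sum using (_⊎_; inj₁; inj₂; map₂)
open import Data.Unit using (tt)
open import Function.Base using (id)
open import Function.Bundles using (_⇔_; mk⇔)
open import Relation.Nullary using (yes; no; does; contradiction)
open import Relation.Nullary.Reflects using (Reflects; ofʸ; ofⁿ; _×-reflects_)
open import Relation.Unary using (Pred; Decidable)
open import Relation.Binary.PropositionalEquality
open import Algebra.Properties.Semiring.Sum +-*-semiring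
  using (sum; sum-syntax; ∑-distrib-+; sum-cong-≗; *-distribʳ-sum; sum-replicate-zero)

iverson : Bool → ℕ
iverson true = 1
iverson false = 0

sum-mono-≤ : ∀ {n} {f g : Vector ℕ n} → (∀ i → f i ≤ g i) → sum f ≤ sum g
sum-mono-≤ {zero} f≤g = z≤n
sum-mono-≤ {suc n} f≤g = +-mono-≤ (f≤g fz) (sum-mono-≤ (λ i → f≤g (fs i)))

sum≡0⇒≡0 : ∀ {n} (f : Vector ℕ n) → sum f ≡ 0 → ∀ i → f i ≡ 0
sum≡0⇒≡0 f Σf≡0 fz = m+n≡0⇒m≡0 (f fz) Σf≡0
sum≡0⇒≡0 f Σf≡0 (fs i) = sum≡0⇒≡0 (λ j → f (fs j)) (m+n≡0⇒n≡0 (f fz) Σf≡0) i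

sum≤1⇒atMostOneNonZero : ∀ {n} (f : Vector ℕ n) → sum f ≤ 1 →
  (∀ i → f i ≡ 0) ⊎ ∃[ p ] (1 ≤ f p × ∀ i → f i ≡ 0 ⊎ i ≡ p)
sum≤1⇒atMostOneNonZero {zero} f Σf≤1 = inj₁ λ ()
sum≤1⇒atMostOneNonZero {suc n} f Σf≤1 with f fz in f₀≡
... | suc _ = inj₂ (fz , subst (1 ≤_) (sym f₀≡) (s≤s z≤n) , onlyZero)
  where
    tail≡0 : sum (λ i → f (fs i)) ≡ 0
    tail≡0 = n≤0⇒n≡0 (s≤s⁻¹ (≤-trans (+-monoˡ-≤ _ (s≤s z≤n)) Σf≤1))
    onlyZero : ∀ i → f i ≡ 0 ⊎ i ≡ fz
    onlyZero fz = inj₂ refl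
    onlyZero (fs i) = inj₁ (sum≡0⇒≡0 _ tail≡0 i)
... | zero with sum≤1⇒atMostOneNonZero (λ i → f (fs i)) Σf≤1
...   | inj₁ tail≡0 = inj₁ λ { fz → f₀≡ ; (fs i) → tail≡0 i }
...   | inj₂ (p , 1≤fp , only) = inj₂ (fs p , 1≤fp , λ { fz → inj₁ f₀≡ ; (fs i) → map₂ (cong fs) (only i) })

∑-weighted-≤ : ∀ {n} (f h : Vector ℕ n) {c} → (∀ i → h i ≤ c) → ∑[ i < n ] (f i * h i) ≤ sum f * c
∑-weighted-≤ f h {c} h≤c = begin
  ∑[ i < _ ] (f i * h i) ≤⟨ sum-mono-≤ (λ i → *-monoʳ-≤ (f i) (h≤c i)) ⟩
  ∑[ i < _ ] (f i * c)   ≡⟨ *-distribʳ-sum c f ⟨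
  sum f * c              ∎
  where open ≤-Reasoning

∑-toℕ≡ᵇ-≤1 : ∀ n x → ∑[ i < n ] iverson (toℕ i ≡ᵇ x) ≤ 1
∑-toℕ≡ᵇ-≤1 zero x = z≤n
∑-toℕ≡ᵇ-≤1 (suc n) zero = s≤s (≤-reflexive (sum-replicate-zero n))
∑-toℕ≡ᵇ-≤1 (suc n) (suc x) = ∑-toℕ≡ᵇ-≤1 n x

length-filter-tabulate : ∀ {A : Set} {ℓ} {P : Pred A ℓ} (P? : Decidable P) n (g : Fin n → A) →
  length (filter P? (tabulate g)) ≡ ∑[ i < n ] iverson (does (P? (g i)))
length-filter-tabulate P? zero g = refl
length-filter-tabulate P? (suc n) g with does (P? (g fz))
... | true = cong suc (length-filter-tabulate P? n (λ i → g (fs i)))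
... | false = length-filter-tabulate P? n (λ i → g (fs i))

discrete-ivt : (f : ℕ → ℕ) → (∀ x → f (suc x) ≤ suc (f x)) →
  ∀ {lo hi c} → lo ≤ hi → f lo ≤ c → c ≤ f hi → ∃[ x ] (lo ≤ x × x ≤ hi × f x ≡ c)
discrete-ivt f step {hi = zero} z≤n flo≤c c≤fhi = 0 , z≤n , z≤n , ≤-antisym flo≤c c≤fhi
discrete-ivt f step {lo} {suc h} {c} lo≤hi flo≤c c≤fhi with lo ≤? h | c ≤? f h
... | yes lo≤h | yes c≤fh =
  let x , lo≤x , x≤h , fx≡c = discrete-ivt f step lo≤h flo≤c c≤fh in x , lo≤x , m≤n⇒m≤1+n x≤h , fx≡c
... | yes _ | no c≰fh = suc h , lo≤hi , ≤-refl , ≤-antisym (≤-trans (step h) (≰⇒> c≰fh)) c≤fhi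
... | no lo≰h | _ = suc h , lo≤hi , ≤-refl , ≤-antisym (subst (λ z → f z ≤ c) lo≡hi flo≤c) c≤fhi
  where lo≡hi = ≤-antisym lo≤hi (≰⇒> lo≰h)

binomSum-suc : ∀ q j → binomSum (suc q) (suc j) ≡ binomSum q (suc j) + binomSum q j
binomSum-suc q zero = begin
  1 + suc q C 1       ≡⟨ cong (1 +_) (nCk+nC[k+1]≡[n+1]C[k+1] q 0) ⟨
  1 + (1 + q C 1)     ≡⟨ +-comm 1 (1 + q C 1) ⟩
  (1 + q C 1) + 1     ∎
  where open ≡-Reasoning
binomSum-suc q (suc j) = begin
  binomSum (suc q) (suc j) + suc q C suc (suc j)
    ≡⟨ cong₂ _+_ (binomSum-suc q j) (sym (nCk+nC[k+1]≡[n+1]C[k+1] q (suc j))) ⟩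
  (binomSum q (suc j) + binomSum q j) + (q C suc j + q C suc (suc j))
    ≡⟨ +-exchange (binomSum q (suc j)) (binomSum q j) (q C suc j) (q C suc (suc j)) ⟩
  (binomSum q (suc j) + q C suc (suc j)) + (binomSum q j + q C suc j) ∎
  where
    open ≡-Reasoning
    +-exchange : ∀ a b c d → (a + b) + (c + d) ≡ (a + d) + (b + c)
    +-exchange = solve-∀

binomSum-zero : ∀ j → binomSum 0 j ≡ 1
binomSum-zero zero = refl
binomSum-zero (suc j) = trans (+-identityʳ _) (binomSum-zero j)

binomSum≤2^ : ∀ q j → binomSum q j ≤ 2 ^ q
binomSum≤2^ zero j = ≤-reflexive (binomSum-zero j)
binomSum≤2^ (suc q) zero = m^n>0 2 (suc q)
binomSum≤2^ (suc q) (suc j) = begin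
  binomSum (suc q) (suc j)             ≡⟨ binomSum-suc q j ⟩
  binomSum q (suc j) + binomSum q j    ≤⟨ +-mono-≤ (binomSum≤2^ q (suc j)) (binomSum≤2^ q j) ⟩
  2 ^ q + 2 ^ q                        ≡⟨ cong (2 ^ q +_) (+-identityʳ (2 ^ q)) ⟨
  2 ^ suc q                            ∎
  where open ≤-Reasoning

weight : ℕ → Fin 5 → ℕ
weight q fz = binomSum q 3
weight q (fs fz) = binomSum q 2
weight q (fs (fs fz)) = binomSum q 1
weight q (fs (fs (fs fz))) = binomSum q 0
weight q (fs (fs (fs (fs fz)))) = 0

isLight : Fin 5 → ℕ
isLight fz = 1
isLight (fs fz) = 1
isLight (fs (fs fz)) = 1
isLight (fs (fs (fs _))) = 0

isThree : Fin 5 → ℕ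
isThree (fs (fs (fs fz))) = 1
isThree _ = 0

weight≤2^ : ∀ q v → weight q v ≤ 2 ^ q
weight≤2^ q fz = binomSum≤2^ q 3
weight≤2^ q (fs fz) = binomSum≤2^ q 2
weight≤2^ q (fs (fs fz)) = binomSum≤2^ q 1
weight≤2^ q (fs (fs (fs fz))) = binomSum≤2^ q 0
weight≤2^ q (fs (fs (fs (fs fz)))) = z≤n

weight-suc : ∀ q v → weight (suc q) v ≡ weight q v + weight q (bump v)
weight-suc q fz = binomSum-suc q 2
weight-suc q (fs fz) = binomSum-suc q 1
weight-suc q (fs (fs fz)) = binomSum-suc q 0
weight-suc q (fs (fs (fs fz))) = refl
weight-suc q (fs (fs (fs (fs fz)))) = refl

weight-answer : ∀ q v b → isLight v ≡ 0 ⊎ b ≡ true →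
  weight q (if b then v else bump v) ≡ isLight v * weight q v + iverson b * isThree v
weight-answer q fz true _ = sym (trans (+-identityʳ _) (+-identityʳ _))
weight-answer q (fs fz) true _ = sym (trans (+-identityʳ _) (+-identityʳ _))
weight-answer q (fs (fs fz)) true _ = sym (trans (+-identityʳ _) (+-identityʳ _))
weight-answer q (fs (fs (fs fz))) true _ = refl
weight-answer q (fs (fs (fs fz))) false _ = refl
weight-answer q (fs (fs (fs (fs fz)))) true _ = refl
weight-answer q (fs (fs (fs (fs fz)))) false _ = refl
weight-answer q fz false (inj₁ ())
weight-answer q (fs fz) false (inj₁ ())
weight-answer q (fs (fs fz)) false (inj₁ ())

weight-split : ∀ q v → weight q v ≡ isLight v * weight q v + isThree v
weight-split q v = trans (weight-answer q v true (inj₂ refl)) (cong (isLight v * weight q v +_) (*-identityˡ (isThree v)))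

isLight-bump-≤ : ∀ v → isLight (bump v) ≤ isLight v
isLight-bump-≤ fz = ≤-refl
isLight-bump-≤ (fs fz) = ≤-refl
isLight-bump-≤ (fs (fs fz)) = z≤n
isLight-bump-≤ (fs (fs (fs fz))) = z≤n
isLight-bump-≤ (fs (fs (fs (fs fz)))) = z≤n

isLight⇒isThree≡0 : ∀ v → 1 ≤ isLight v → isThree v ≡ 0
isLight⇒isThree≡0 fz _ = refl
isLight⇒isThree≡0 (fs fz) _ = refl
isLight⇒isThree≡0 (fs (fs fz)) _ = refl

isThree≤1 : ∀ v → isThree v ≤ 1
isThree≤1 (fs (fs (fs fz))) = ≤-refl
isThree≤1 fz = z≤n
isThree≤1 (fs fz) = z≤n
isThree≤1 (fs (fs fz)) = z≤n
isThree≤1 (fs (fs (fs (fs fz)))) = z≤n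

balanced-split : ∀ {E F k P Y Z} → E ≤ P → E + F + k ≤ 2 * P →
  Y ≡ E + (F + k ∸ P) → E + F + k ≡ Y + Z → Y ≤ P × Z ≤ P
balanced-split {E} {F} {k} {P} {Y} {Z} E≤P W≤2P Y≡ W≡Y+Z = Y≤P , Z≤P
  where
    W≤Y+P : E + F + k ≤ Y + P
    W≤Y+P = begin
      E + F + k              ≡⟨ +-assoc E F k ⟩
      E + (F + k)            ≤⟨ +-monoʳ-≤ E (m≤n+m∸n (F + k) P) ⟩
      E + (P + (F + k ∸ P))  ≡⟨ cong (E +_) (+-comm P (F + k ∸ P)) ⟩
      E + (F + k ∸ P + P)    ≡⟨ +-assoc E (F + k ∸ P) P ⟨
      E + (F + k ∸ P) + P    ≡⟨ cong (_+ P) Y≡ ⟨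
      Y + P                  ∎
      where open ≤-Reasoning
    Z≤P : Z ≤ P
    Z≤P = +-cancelˡ-≤ Y Z P (≤-trans (≤-reflexive (sym W≡Y+Z)) W≤Y+P)
    Y≤P : Y ≤ P
    Y≤P with F + k ≤? P
    ... | yes F+k≤P = begin
      Y                      ≡⟨ Y≡ ⟩
      E + (F + k ∸ P)        ≡⟨ cong (E +_) (m≤n⇒m∸n≡0 F+k≤P) ⟩
      E + 0                  ≡⟨ +-identityʳ E ⟩
      E                      ≤⟨ E≤P ⟩
      P                      ∎
      where open ≤-Reasoning
    ... | no F+k≰P = +-cancelʳ-≤ P Y P (begin
      Y + P                  ≡⟨ cong (_+ P) Y≡ ⟩
      E + (F + k ∸ P) + P    ≡⟨ +-assoc E (F + k ∸ P) P ⟩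
      E + (F + k ∸ P + P)    ≡⟨ cong (E +_) (m∸n+n≡m (<⇒≤ (≰⇒> F+k≰P))) ⟩
      E + (F + k)            ≡⟨ +-assoc E F k ⟨
      E + F + k              ≤⟨ W≤2P ⟩
      P + (P + 0)            ≡⟨ cong (P +_) (+-identityʳ P) ⟩
      P + P                  ∎)
      where open ≤-Reasoning

module _ (m : ℕ) where

  volume : ℕ → State m → ℕ
  volume q σ = ∑[ y < 2 ^ m ] weight q (σ y)

  lightCount : State m → ℕ
  lightCount σ = ∑[ y < 2 ^ m ] isLight (σ y)

  threeCount : State m → ℕ
  threeCount σ = ∑[ y < 2 ^ m ] isThree (σ y)

  volume-answers : ∀ q σ Q → volume (suc q) σ ≡ volume q (yesState m σ Q) + volume q (noState m σ Q)
  volume-answers q σ Q = trans (sum-cong-≗ {2 ^ m} (λ y → pointwise (σ y) (Q y))) (∑-distrib-+ {2 ^ m} _ _)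
    where
      pointwise : ∀ v b → weight (suc q) v ≡ weight q (if b then v else bump v) + weight q (if b then bump v else v)
      pointwise v true = weight-suc q v
      pointwise v false = trans (weight-suc q v) (+-comm (weight q v) (weight q (bump v)))

  lightCount-yes-≤ : ∀ σ Q → lightCount (yesState m σ Q) ≤ lightCount σ
  lightCount-yes-≤ σ Q = sum-mono-≤ λ y → pointwise (σ y) (Q y)
    where
      pointwise : ∀ v b → isLight (if b then v else bump v) ≤ isLight v
      pointwise v true = ≤-refl
      pointwise v false = isLight-bump-≤ v

  lightCount-no-≤ : ∀ σ Q → lightCount (noState m σ Q) ≤ lightCount σ
  lightCount-no-≤ σ Q = sum-mono-≤ λ y → pointwise (σ y) (Q y)
    where
      pointwise : ∀ v b → isLight (if b then bump v else v) ≤ isLight v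
      pointwise v true = isLight-bump-≤ v
      pointwise v false = ≤-refl

  volume-zero : ∀ σ → volume 0 σ ≡ length (support m σ)
  volume-zero σ = sym (trans (length-filter-tabulate (λ y → val m σ y ≤? 3) (2 ^ m) id)
                             (sum-cong-≗ {2 ^ m} λ y → inSupport (σ y)))
    where
      inSupport : ∀ v → iverson (does (toℕ v ≤? 3)) ≡ weight 0 v
      inSupport fz = refl
      inSupport (fs fz) = refl
      inSupport (fs (fs fz)) = refl
      inSupport (fs (fs (fs fz))) = refl
      inSupport (fs (fs (fs (fs fz)))) = refl

  private
    [_≡ᵛ_] : Fin 5 → ℕ → ℕ
    [ v ≡ᵛ i ] = iverson (does (toℕ v ≟ i))

  count≡sum : ∀ σ i → t m σ i ≡ ∑[ y < 2 ^ m ] [ σ y ≡ᵛ i ]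
  count≡sum σ i = length-filter-tabulate (λ y → val m σ y ≟ i) (2 ^ m) id

  lightCount≡t₀+t₁+t₂ : ∀ σ → t m σ 0 + t m σ 1 + t m σ 2 ≡ lightCount σ
  lightCount≡t₀+t₁+t₂ σ = begin
    t m σ 0 + t m σ 1 + t m σ 2
      ≡⟨ cong₂ _+_ (cong₂ _+_ (count≡sum σ 0) (count≡sum σ 1)) (count≡sum σ 2) ⟩
    ∑[ y < 2 ^ m ] [ σ y ≡ᵛ 0 ] + ∑[ y < 2 ^ m ] [ σ y ≡ᵛ 1 ] + ∑[ y < 2 ^ m ] [ σ y ≡ᵛ 2 ]
      ≡⟨ cong (_+ ∑[ y < 2 ^ m ] [ σ y ≡ᵛ 2 ])
              (∑-distrib-+ {2 ^ m} (λ y → [ σ y ≡ᵛ 0 ]) (λ y → [ σ y ≡ᵛ 1 ])) ⟨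
    ∑[ y < 2 ^ m ] ([ σ y ≡ᵛ 0 ] + [ σ y ≡ᵛ 1 ]) + ∑[ y < 2 ^ m ] [ σ y ≡ᵛ 2 ]
      ≡⟨ ∑-distrib-+ {2 ^ m} (λ y → [ σ y ≡ᵛ 0 ] + [ σ y ≡ᵛ 1 ]) (λ y → [ σ y ≡ᵛ 2 ]) ⟨
    ∑[ y < 2 ^ m ] ([ σ y ≡ᵛ 0 ] + [ σ y ≡ᵛ 1 ] + [ σ y ≡ᵛ 2 ])
      ≡⟨ sum-cong-≗ {2 ^ m} (λ y → pointwise (σ y)) ⟩
    lightCount σ ∎
    where
      open ≡-Reasoning
      pointwise : ∀ v → [ v ≡ᵛ 0 ] + [ v ≡ᵛ 1 ] + [ v ≡ᵛ 2 ] ≡ isLight v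
      pointwise fz = refl
      pointwise (fs fz) = refl
      pointwise (fs (fs fz)) = refl
      pointwise (fs (fs (fs fz))) = refl
      pointwise (fs (fs (fs (fs fz)))) = refl

  w≡volume : ∀ q σ → w m q σ ≡ volume q σ
  w≡volume q σ = begin
    t m σ 0 * b₃ + t m σ 1 * b₂ + t m σ 2 * b₁ + t m σ 3 * b₀
      ≡⟨ cong₂ _+_ (cong₂ _+_ (cong₂ _+_ (scaled 0 b₃) (scaled 1 b₂)) (scaled 2 b₁)) (scaled 3 b₀) ⟩
    ∑[ y < 2 ^ m ] c 0 b₃ y + ∑[ y < 2 ^ m ] c 1 b₂ y + ∑[ y < 2 ^ m ] c 2 b₁ y + ∑[ y < 2 ^ m ] c 3 b₀ y
      ≡⟨ cong (λ s → s + ∑[ y < 2 ^ m ] c 2 b₁ y + ∑[ y < 2 ^ m ] c 3 b₀ y)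
              (∑-distrib-+ {2 ^ m} (c 0 b₃) (c 1 b₂)) ⟨
    ∑[ y < 2 ^ m ] (c 0 b₃ y + c 1 b₂ y) + ∑[ y < 2 ^ m ] c 2 b₁ y + ∑[ y < 2 ^ m ] c 3 b₀ y
      ≡⟨ cong (_+ ∑[ y < 2 ^ m ] c 3 b₀ y) (∑-distrib-+ {2 ^ m} (λ y → c 0 b₃ y + c 1 b₂ y) (c 2 b₁)) ⟨
    ∑[ y < 2 ^ m ] (c 0 b₃ y + c 1 b₂ y + c 2 b₁ y) + ∑[ y < 2 ^ m ] c 3 b₀ y
      ≡⟨ ∑-distrib-+ {2 ^ m} (λ y → c 0 b₃ y + c 1 b₂ y + c 2 b₁ y) (c 3 b₀) ⟨
    ∑[ y < 2 ^ m ] (c 0 b₃ y + c 1 b₂ y + c 2 b₁ y + c 3 b₀ y)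
      ≡⟨ sum-cong-≗ {2 ^ m} (λ y → pointwise (σ y)) ⟩
    volume q σ ∎
    where
      open ≡-Reasoning
      b₃ = binomSum q 3
      b₂ = binomSum q 2
      b₁ = binomSum q 1
      b₀ = binomSum q 0
      c : ℕ → ℕ → Vector ℕ (2 ^ m)
      c i b y = [ σ y ≡ᵛ i ] * b
      scaled : ∀ i b → t m σ i * b ≡ ∑[ y < 2 ^ m ] c i b y
      scaled i b = trans (cong (_* b) (count≡sum σ i)) (*-distribʳ-sum b (λ y → [ σ y ≡ᵛ i ]))
      pointwise : ∀ v → [ v ≡ᵛ 0 ] * b₃ + [ v ≡ᵛ 1 ] * b₂ + [ v ≡ᵛ 2 ] * b₁ + [ v ≡ᵛ 3 ] * b₀ ≡ weight q v
      pointwise fz = trans (+-identityʳ _) (trans (+-identityʳ _) (trans (+-identityʳ _) (+-identityʳ _)))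
      pointwise (fs fz) = trans (+-identityʳ _) (trans (+-identityʳ _) (+-identityʳ _))
      pointwise (fs (fs fz)) = trans (+-identityʳ _) (+-identityʳ _)
      pointwise (fs (fs (fs fz))) = refl
      pointwise (fs (fs (fs (fs fz)))) = refl

  inRange : ℕ → ℕ → Question m
  inRange a b y = (a ≤ᵇ toℕ y) ∧ (toℕ y <ᵇ b)

  inRange-reflects : ∀ a b y → Reflects (a ≤ toℕ y × toℕ y < b) (inRange a b y)
  inRange-reflects a b y = ≤ᵇ-reflects-≤ a (toℕ y) ×-reflects <ᵇ-reflects-< (toℕ y) b

  inRange-true : ∀ {a b} y → a ≤ toℕ y → toℕ y < b → inRange a b y ≡ true
  inRange-true {a} {b} y a≤y y<b with inRange a b y | inRange-reflects a b y
  ... | true | _ = refl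
  ... | false | ofⁿ ¬in = contradiction (a≤y , y<b) ¬in

  countIn : Vector ℕ (2 ^ m) → ℕ → ℕ → ℕ
  countIn g a b = ∑[ y < 2 ^ m ] (iverson (inRange a b y) * g y)

  countIn-split : ∀ g {a b c} → a ≤ b → b ≤ c → countIn g a c ≡ countIn g a b + countIn g b c
  countIn-split g {a} {b} {c} a≤b b≤c = trans (sum-cong-≗ {2 ^ m} pointwise) (∑-distrib-+ {2 ^ m} _ _)
    where
      pointwise : ∀ y → iverson (inRange a c y) * g y ≡ iverson (inRange a b y) * g y + iverson (inRange b c y) * g y
      pointwise y with inRange a c y | inRange-reflects a c y | inRange a b y | inRange-reflects a b y
                     | inRange b c y | inRange-reflects b c y
      ... | _ | _ | true | ofʸ (_ , y<b) | true | ofʸ (b≤y , _) = contradiction b≤y (<⇒≱ y<b)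
      ... | true | _ | true | _ | false | _ = sym (+-identityʳ _)
      ... | true | _ | false | _ | true | _ = refl
      ... | true | ofʸ (a≤y , y<c) | false | ofⁿ ¬ab | false | ofⁿ ¬bc with toℕ y <? b
      ...   | yes y<b = contradiction (a≤y , y<b) ¬ab
      ...   | no y≮b = contradiction (≮⇒≥ y≮b , y<c) ¬bc
      pointwise y | false | ofⁿ ¬ac | true | ofʸ (a≤y , y<b) | _ | _ = contradiction (a≤y , <-≤-trans y<b b≤c) ¬ac
      pointwise y | false | ofⁿ ¬ac | false | _ | true | ofʸ (b≤y , y<c) = contradiction (≤-trans a≤b b≤y , y<c) ¬ac
      pointwise y | false | _ | false | _ | false | _ = refl

  countIn-empty : ∀ g → countIn g 0 0 ≡ 0
  countIn-empty g = sum-replicate-zero (2 ^ m)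

  countIn-full : ∀ g → countIn g 0 (2 ^ m) ≡ sum g
  countIn-full g = sum-cong-≗ {2 ^ m} pointwise
    where
      pointwise : ∀ y → iverson (inRange 0 (2 ^ m) y) * g y ≡ g y
      pointwise y with inRange 0 (2 ^ m) y | inRange-reflects 0 (2 ^ m) y
      ... | true | _ = +-identityʳ (g y)
      ... | false | ofⁿ ¬in = contradiction (z≤n , toℕ<n y) ¬in

  countIn-unit-≤ : ∀ g → (∀ y → g y ≤ 1) → ∀ x → countIn g x (suc x) ≤ 1
  countIn-unit-≤ g g≤1 x = ≤-trans (sum-mono-≤ pointwise) (∑-toℕ≡ᵇ-≤1 (2 ^ m) x)
    where
      pointwise : ∀ y → iverson (inRange x (suc x) y) * g y ≤ iverson (toℕ y ≡ᵇ x)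
      pointwise y with inRange x (suc x) y | inRange-reflects x (suc x) y
      ... | false | _ = z≤n
      ... | true | ofʸ (x≤y , y<1+x) with toℕ y ≡ᵇ x | ≡⇒≡ᵇ (toℕ y) x (≤-antisym (s≤s⁻¹ y<1+x) x≤y)
      ...   | true | _ = ≤-trans (≤-reflexive (+-identityʳ (g y))) (g≤1 y)

  countIn-unit-zero : ∀ g p → g p ≡ 0 → countIn g (toℕ p) (suc (toℕ p)) ≡ 0
  countIn-unit-zero g p gp≡0 = trans (sum-cong-≗ {2 ^ m} pointwise) (sum-replicate-zero (2 ^ m))
    where
      pointwise : ∀ y → iverson (inRange (toℕ p) (suc (toℕ p)) y) * g y ≡ 0
      pointwise y with inRange (toℕ p) (suc (toℕ p)) y | inRange-reflects (toℕ p) (suc (toℕ p)) y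
      ... | false | _ = refl
      ... | true | ofʸ (p≤y , y<1+p) with toℕ-injective {i = y} {j = p} (≤-antisym (s≤s⁻¹ y<1+p) p≤y)
      ...   | refl = trans (+-identityʳ (g y)) gp≡0

  countIn-step : ∀ g → (∀ y → g y ≤ 1) → ∀ x → countIn g 0 (suc x) ≤ suc (countIn g 0 x)
  countIn-step g g≤1 x = begin
    countIn g 0 (suc x)                  ≡⟨ countIn-split g z≤n (n≤1+n x) ⟩
    countIn g 0 x + countIn g x (suc x)  ≤⟨ +-monoʳ-≤ (countIn g 0 x) (countIn-unit-≤ g g≤1 x) ⟩
    countIn g 0 x + 1                    ≡⟨ +-comm (countIn g 0 x) 1 ⟩
    suc (countIn g 0 x)                  ∎
    where open ≤-Reasoning

  countIn-skip : ∀ g p → g p ≡ 0 → countIn g 0 (suc (toℕ p)) ≡ countIn g 0 (toℕ p)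
  countIn-skip g p gp≡0 = begin
    countIn g 0 (suc (toℕ p))                            ≡⟨ countIn-split g z≤n (n≤1+n (toℕ p)) ⟩
    countIn g 0 (toℕ p) + countIn g (toℕ p) (suc (toℕ p)) ≡⟨ cong (countIn g 0 (toℕ p) +_) (countIn-unit-zero g p gp≡0) ⟩
    countIn g 0 (toℕ p) + 0                              ≡⟨ +-identityʳ _ ⟩
    countIn g 0 (toℕ p)                                  ∎
    where open ≡-Reasoning

  prefixWithCount : ∀ g → (∀ y → g y ≤ 1) → ∀ {i} → i ≤ sum g → ∃[ b ] (b ≤ 2 ^ m × countIn g 0 b ≡ i)
  prefixWithCount g g≤1 i≤Σg =
    let b , _ , b≤N , count≡i = discrete-ivt (countIn g 0) (countIn-step g g≤1) z≤n
                                  (≤-trans (≤-reflexive (countIn-empty g)) z≤n)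
                                  (subst (_ ≤_) (sym (countIn-full g)) i≤Σg)
    in b , b≤N , count≡i

  -- Either the interval starts at p and runs forward, or, if too few counted elements
  -- follow p, it ends at 2 ^ m and starts at or before p.
  intervalAroundWithCount : ∀ g → (∀ y → g y ≤ 1) → ∀ p → g p ≡ 0 → ∀ {i} → i ≤ sum g →
    ∃[ a ] ∃[ b ] (a ≤ toℕ p × toℕ p < b × b ≤ 2 ^ m × countIn g a b ≡ i)
  intervalAroundWithCount g g≤1 p gp≡0 {i} i≤Σg with countIn g 0 (toℕ p) + i ≤? sum g
  ... | yes fits =
    let b , p<b , b≤N , prefix≡ = discrete-ivt (countIn g 0) (countIn-step g g≤1) (toℕ<n p)
                                    (≤-trans (≤-reflexive (countIn-skip g p gp≡0)) (m≤m+n _ i))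
                                    (subst (countIn g 0 (toℕ p) + i ≤_) (sym (countIn-full g)) fits)
    in toℕ p , b , ≤-refl , p<b , b≤N ,
       +-cancelˡ-≡ (countIn g 0 (toℕ p)) _ _ (trans (sym (countIn-split g z≤n (<⇒≤ p<b))) prefix≡)
  ... | no overflows =
    let a , _ , a≤p , prefix≡ = discrete-ivt (countIn g 0) (countIn-step g g≤1) z≤n
                                  (≤-trans (≤-reflexive (countIn-empty g)) z≤n)
                                  (m≤n+o⇒m∸n≤o (sum g) i (≤-trans (<⇒≤ (≰⇒> overflows)) (≤-reflexive (+-comm _ i))))
    in a , 2 ^ m , a≤p , toℕ<n p , ≤-refl ,
       +-cancelˡ-≡ (sum g ∸ i) _ _ (begin
         sum g ∸ i + countIn g a (2 ^ m)        ≡⟨ cong (_+ countIn g a (2 ^ m)) prefix≡ ⟨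
         countIn g 0 a + countIn g a (2 ^ m)    ≡⟨ countIn-split g z≤n (<⇒≤ (≤-<-trans a≤p (toℕ<n p))) ⟨
         countIn g 0 (2 ^ m)                    ≡⟨ countIn-full g ⟩
         sum g                                  ≡⟨ m∸n+n≡m i≤Σg ⟨
         sum g ∸ i + i                          ∎)
    where open ≡-Reasoning

  private instance
    2^m≢0 : NonZero (2 ^ m)
    2^m≢0 = m^n≢0 2 m

  inRange-isInterval : ∀ {a b} → a < 2 ^ m → b ≤ 2 ^ m → IsInterval m (inRange a b)
  inRange-isInterval {a} {b} a<N b≤N =
    fromℕ< a<N , b ∸ a , ≤-trans (m∸n≤m b a) b≤N ,
    λ y → subst (λ s → (inRange a b y ≡ true) ⇔ (offset s y < b ∸ a)) (sym (toℕ-fromℕ< a<N)) (membership y)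
    where
      offset : ℕ → Fin (2 ^ m) → ℕ
      offset s y = (toℕ y + (2 ^ m ∸ s)) % 2 ^ m

      offset-≥ : ∀ y → a ≤ toℕ y → offset a y ≡ toℕ y ∸ a
      offset-≥ y a≤y = begin
        (toℕ y + (2 ^ m ∸ a)) % 2 ^ m          ≡⟨ cong (_% 2 ^ m) shift ⟩
        (toℕ y ∸ a + 2 ^ m) % 2 ^ m            ≡⟨ [m+n]%n≡m%n (toℕ y ∸ a) (2 ^ m) ⟩
        (toℕ y ∸ a) % 2 ^ m                    ≡⟨ m<n⇒m%n≡m (≤-<-trans (m∸n≤m (toℕ y) a) (toℕ<n y)) ⟩
        toℕ y ∸ a                              ∎
        where
          open ≡-Reasoning
          shift : toℕ y + (2 ^ m ∸ a) ≡ toℕ y ∸ a + 2 ^ m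
          shift = begin
            toℕ y + (2 ^ m ∸ a)                ≡⟨ cong (_+ (2 ^ m ∸ a)) (m∸n+n≡m a≤y) ⟨
            toℕ y ∸ a + a + (2 ^ m ∸ a)        ≡⟨ +-assoc (toℕ y ∸ a) a (2 ^ m ∸ a) ⟩
            toℕ y ∸ a + (a + (2 ^ m ∸ a))      ≡⟨ cong (toℕ y ∸ a +_) (m+[n∸m]≡n (<⇒≤ a<N)) ⟩
            toℕ y ∸ a + 2 ^ m                  ∎

      offset-< : ∀ y → toℕ y < a → offset a y ≡ toℕ y + (2 ^ m ∸ a)
      offset-< y y<a = m<n⇒m%n≡m (≤-trans (+-monoˡ-< (2 ^ m ∸ a) y<a) (≤-reflexive (m+[n∸m]≡n (<⇒≤ a<N))))

      membership : ∀ y → (inRange a b y ≡ true) ⇔ (offset a y < b ∸ a)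
      membership y with a ≤ᵇ toℕ y | ≤ᵇ-reflects-≤ a (toℕ y)
      ... | false | ofⁿ a≰y rewrite offset-< y (≰⇒> a≰y) =
        mk⇔ (λ ()) (λ lt → contradiction lt (≤⇒≯ (≤-trans (∸-monoˡ-≤ a b≤N) (m≤n+m (2 ^ m ∸ a) (toℕ y)))))
      ... | true | ofʸ a≤y rewrite offset-≥ y a≤y with toℕ y <ᵇ b | <ᵇ-reflects-< (toℕ y) b
      ...   | true | ofʸ y<b = mk⇔ (λ _ → ∸-monoˡ-< y<b a≤y) (λ _ → refl)
      ...   | false | ofⁿ y≮b = mk⇔ (λ ()) (λ lt → contradiction lt (≤⇒≯ (∸-monoˡ-≤ a (≮⇒≥ y≮b))))

  coveringInterval : ∀ σ → lightCount σ ≤ 1 → ∀ {i} → i ≤ threeCount σ →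
    Σ (Question m) λ Q → IsInterval m Q × (∀ y → isLight (σ y) ≡ 0 ⊎ Q y ≡ true) ×
                         ∑[ y < 2 ^ m ] (iverson (Q y) * isThree (σ y)) ≡ i
  coveringInterval σ lights≤1 i≤k with sum≤1⇒atMostOneNonZero (λ y → isLight (σ y)) lights≤1
  ... | inj₁ noLight =
    let b , b≤N , count≡i = prefixWithCount (λ y → isThree (σ y)) (λ y → isThree≤1 (σ y)) i≤k
    in inRange 0 b , inRange-isInterval (m^n>0 2 m) b≤N , (λ y → inj₁ (noLight y)) , count≡i
  ... | inj₂ (p , p-light , onlyP) =
    let a , b , a≤p , p<b , b≤N , count≡i = intervalAroundWithCount (λ y → isThree (σ y)) (λ y → isThree≤1 (σ y))
                                               p (isLight⇒isThree≡0 (σ p) p-light) i≤k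
        covers : ∀ y → isLight (σ y) ≡ 0 ⊎ inRange a b y ≡ true
        covers y = map₂ (λ { refl → inRange-true p a≤p p<b }) (onlyP y)
    in inRange a b , inRange-isInterval (≤-<-trans a≤p (toℕ<n p)) b≤N , covers , count≡i

  balancedInterval : ∀ q σ → lightCount σ ≤ 1 → volume (suc q) σ ≤ 2 ^ suc q →
    Σ (Question m) λ Q → IsInterval m Q × volume q (yesState m σ Q) ≤ 2 ^ q × volume q (noState m σ Q) ≤ 2 ^ q
  balancedInterval q σ lights≤1 vol≤ =
    let Q , Q-interval , covers , count≡i = coveringInterval σ lights≤1 i≤k
    in Q , Q-interval , balanced-split (lightVolume≤2^ id) (subst (_≤ 2 ^ suc q) volume≡E+F+k vol≤)
                          (yesVolume≡E+i Q covers count≡i) (trans (sym volume≡E+F+k) (volume-answers q σ Q))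
    where
      lightVolume : (Fin 5 → Fin 5) → ℕ
      lightVolume f = ∑[ y < 2 ^ m ] (isLight (σ y) * weight q (f (σ y)))

      lightVolume≤2^ : ∀ f → lightVolume f ≤ 2 ^ q
      lightVolume≤2^ f = begin
        lightVolume f                ≤⟨ ∑-weighted-≤ (λ y → isLight (σ y)) (λ y → weight q (f (σ y)))
                                                         (λ y → weight≤2^ q (f (σ y))) ⟩
        lightCount σ * 2 ^ q         ≤⟨ *-monoˡ-≤ (2 ^ q) lights≤1 ⟩
        1 * 2 ^ q                    ≡⟨ *-identityˡ (2 ^ q) ⟩
        2 ^ q                        ∎
        where open ≤-Reasoning

      E F k i : ℕ
      E = lightVolume id
      F = lightVolume bump
      k = threeCount σ
      i = F + k ∸ 2 ^ q

      i≤k : i ≤ k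
      i≤k = ≤-trans (∸-monoˡ-≤ (2 ^ q) (+-monoˡ-≤ k (lightVolume≤2^ bump))) (≤-reflexive (m+n∸m≡n (2 ^ q) k))

      volume≡E+F+k : volume (suc q) σ ≡ E + F + k
      volume≡E+F+k = begin
        volume (suc q) σ
          ≡⟨ sum-cong-≗ {2 ^ m} (λ y → pointwise (σ y)) ⟩
        ∑[ y < 2 ^ m ] (isLight (σ y) * weight q (σ y) + isLight (σ y) * weight q (bump (σ y)) + isThree (σ y))
          ≡⟨ ∑-distrib-+ {2 ^ m} _ (λ y → isThree (σ y)) ⟩
        ∑[ y < 2 ^ m ] (isLight (σ y) * weight q (σ y) + isLight (σ y) * weight q (bump (σ y))) + k
          ≡⟨ cong (_+ k) (∑-distrib-+ {2 ^ m} _ _) ⟩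
        E + F + k ∎
        where
          open ≡-Reasoning
          pointwise : ∀ v → weight (suc q) v ≡ isLight v * weight q v + isLight v * weight q (bump v) + isThree v
          pointwise v = begin
            weight (suc q) v                                          ≡⟨ weight-split (suc q) v ⟩
            isLight v * weight (suc q) v + isThree v                      ≡⟨ cong (λ x → isLight v * x + isThree v) (weight-suc q v) ⟩
            isLight v * (weight q v + weight q (bump v)) + isThree v      ≡⟨ cong (_+ isThree v) (*-distribˡ-+ (isLight v) _ _) ⟩
            isLight v * weight q v + isLight v * weight q (bump v) + isThree v ∎

      yesVolume≡E+i : ∀ Q → (∀ y → isLight (σ y) ≡ 0 ⊎ Q y ≡ true) →
        ∑[ y < 2 ^ m ] (iverson (Q y) * isThree (σ y)) ≡ i → volume q (yesState m σ Q) ≡ E + i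
      yesVolume≡E+i Q covers count≡i = begin
        volume q (yesState m σ Q)
          ≡⟨ sum-cong-≗ {2 ^ m} (λ y → weight-answer q (σ y) (Q y) (covers y)) ⟩
        ∑[ y < 2 ^ m ] (isLight (σ y) * weight q (σ y) + iverson (Q y) * isThree (σ y))
          ≡⟨ ∑-distrib-+ {2 ^ m} _ _ ⟩
        E + ∑[ y < 2 ^ m ] (iverson (Q y) * isThree (σ y))
          ≡⟨ cong (E +_) count≡i ⟩
        E + i ∎
        where open ≡-Reasoning

  intervalStrategy : ∀ q σ → lightCount σ ≤ 1 → volume q σ ≤ 2 ^ q →
    Σ (Strategy m q) λ S → Winning m S σ × OneIntervalOnly m S
  intervalStrategy zero σ _ vol≤1 = leaf , subst (_≤ 1) (volume-zero σ) vol≤1 , tt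
  intervalStrategy (suc q) σ lights≤1 vol≤ =
    let Q , Q-interval , yes≤ , no≤ = balancedInterval q σ lights≤1 vol≤
        Sʸ , Sʸ-wins , Sʸ-intervals =
          intervalStrategy q (yesState m σ Q) (≤-trans (lightCount-yes-≤ σ Q) lights≤1) yes≤
        Sⁿ , Sⁿ-wins , Sⁿ-intervals =
          intervalStrategy q (noState m σ Q) (≤-trans (lightCount-no-≤ σ Q) lights≤1) no≤
    in node Q Sʸ Sⁿ , (Sʸ-wins , Sⁿ-wins) , (Q-interval , Sʸ-intervals , Sⁿ-intervals)

proposition2 : (m : ℕ) (σ : State m) →
    WellShaped m σ → 0 < t m σ 3 → t m σ 0 + t m σ 1 + t m σ 2 ≤ 1 →
    (q : ℕ) → IsCharacter m σ q →
    Σ (Strategy m q) (λ S → Winning m S σ × OneIntervalOnly m S)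
proposition2 m σ _ _ t₀+t₁+t₂≤1 q (w≤2^q , _) =
  intervalStrategy m q σ (subst (_≤ 1) (lightCount≡t₀+t₁+t₂ m σ) t₀+t₁+t₂≤1)
                         (subst (_≤ 2 ^ q) (w≡volume m q σ) w≤2^q)
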